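{- Let $k \ge 2$ and $n \ge 1$. If a length-2 word $B$ has a straddling occurrence in $W_n^{(k)}$, then $B=(0.n)$ if $n<k$, and $B=(n-k+1\,.\,k)$ if $n\ge k$. In particular, there is exactly one such straddling occurrence.
   Context: Words are over the alphabet $\mathbb{N}=\{0,1,2,\dots\}$; $(x.y)$ denotes the length-2 word with letters $x,y$. For $n\in\mathbb{N}$ and a word $W=w_0\cdots w_{m-1}$, $n\oplus W=(w_0+n)\cdots(w_{m-1}+n)$. For $k\ge 2$, $\phi_k$ is the morphism of $\mathbb{N}^*$ defined for $i\in\mathbb{N}$, $0\le j\le k-1$ by $\phi_k(ki+j)=(ki)(ki+j+1)$ if $0\le j\le k-2$ and $\phi_k(ki+k-1)=ki+k$; $W_n^{(k)}=\phi_k^n(0)$. It is known that for $n\ge1$: $W_n^{(k)}=W_{n-1}^{(k)}\cdots W_0^{(k)}\,n$ if $n<k$, and $W_n^{(k)}=W_{n-1}^{(k)}\cdots W_{n-k+1}^{(k)}(k\oplus W_{n-k}^{(k)})$ if $n\ge k$. Let $s=\max\{n-k+1,0\}$; call $P_n=W_{n-1}^{(k)}\cdots W_s^{(k)}$ the prefix and $T_n$ the terminal block (the letter $n$ if $n<k$, the word $k\oplus W_{n-k}^{(k)}$ if $n\ge k$), so $W_n^{(k)}=P_nT_n$. An occurrence of a word $U$ in $W_n^{(k)}$ is straddling if it is written $U=PQ$ with $P,Q$ nonempty, $P$ a suffix of $P_n$ and $Q$ a prefix of $T_n$ (at this junction), i.e. the occurrence overlaps both $P_n$ and $T_n$. 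-}

module Defs where

open import Data.Nat using (ℕ; zero; suc; _+_; _*_; _∸_; _<_; _≤_; _<ᵇ_)
open import Data.Nat.DivMod using (_/_; _%_)
open import Data.List using (List; []; _∷_; _++_; concatMap; concat; map; upTo; length; take; drop)
open import Data.Bool using (if_then_else_)
open import Data.Product using (_×_)
open import Relation.Binary.PropositionalEquality using (_≡_)

-- The morphism φ_k on a single letter a = k*i + j  (0 ≤ j ≤ k-1):
--   φ_k(ki+j) = (ki)(ki+j+1) if j ≤ k-2,   φ_k(ki+k-1) = ki+k.
-- (For k = 0 the value is irrelevant; the lemma assumes k ≥ 2.)
φ : ℕ → ℕ → List ℕ
φ zero a = []
φ (suc m) a =
  let k = suc m ; i = a / k ; j = a % k in
  if suc j <ᵇ k then (k * i) ∷ (k * i + suc j) ∷ [] else (k * i + k) ∷ []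

φ* : ℕ → List ℕ → List ℕ
φ* k = concatMap (φ k)

W : ℕ → ℕ → List ℕ
W k zero = 0 ∷ []
W k (suc n) = φ* k (W k n)

_⊕_ : ℕ → List ℕ → List ℕ
n ⊕ w = map (n +_) w

start : ℕ → ℕ → ℕ
start k n = suc n ∸ k

-- Prefix P_n = W_{n-1} W_{n-2} ... W_s
P : ℕ → ℕ → List ℕ
P k n = concat (map (λ i → W k (n ∸ 1 ∸ i)) (upTo (n ∸ start k n)))

T : ℕ → ℕ → List ℕ
T k n = if n <ᵇ k then n ∷ [] else k ⊕ W k (n ∸ k)

OccursAt : ℕ → ℕ → List ℕ → ℕ → Set
OccursAt k n U i = take (length U) (drop i (W k n)) ≡ U

-- A straddling occurrence of U at position i in W_n^{(k)} = P_n T_n :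
-- it starts inside P_n and ends inside T_n (overlaps both at the junction).
StraddlingAt : ℕ → ℕ → List ℕ → ℕ → Set
StraddlingAt k n U i =
  OccursAt k n U i × (i < length (P k n)) × (length (P k n) < i + length U)

{-# OPTIONS --safe #-}
module Submission where

-- The block decomposition W_n = P_n T_n holds for every n, where P_n = W_{n-1} ⋯ W_s:
-- for n < k it is W_n = W_{n-1} ⋯ W_0 n, and for n ≥ k it is obtained by applying φ_k,
-- which shifts every block up by one and commutes with k ⊕ _. Since φ_k(a) ends with
-- a + 1 and φ_k(0) = 0 1, every W_d ends with d and starts with 0. Hence P_n ends with
-- s, and T_n starts with n (if n < k) or with k + 0 (if n ≥ k). A straddling
-- occurrence of length 2 must start at the last letter of P_n, so it is that pair.

open import Data.Bool using (true; false; if_then_else_)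
open import Data.List using (List; []; _∷_; [_]; _++_; _∷ʳ_; length; take; drop; map; concat; upTo)
open import Data.List.Properties
  using (++-assoc; ++-identityʳ; length-++; map-++; concat-++; concatMap-++; map-cong; upTo-∷ʳ)
open import Data.Nat
open import Data.Nat.Properties
open import Data.Nat.DivMod
open import Data.Nat.Divisibility using (∣-refl)
open import Data.Product using (Σ; ∃; _×_; _,_; proj₁)
open import Function using (_∘_)
open import Relation.Binary.PropositionalEquality hiding ([_])
open import Relation.Nullary.Decidable using (yes; no)
open import Relation.Nullary.Reflects using (ofⁿ)

open import Defs

<⇒<ᵇ≡true : ∀ {a b} → a < b → (a <ᵇ b) ≡ true
<⇒<ᵇ≡true {zero}  {suc b} _         = refl
<⇒<ᵇ≡true {suc a} {suc b} (s≤s a<b) = <⇒<ᵇ≡true a<b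

≥⇒<ᵇ≡false : ∀ {a b} → b ≤ a → (a <ᵇ b) ≡ false
≥⇒<ᵇ≡false {_}     {zero}  _         = refl
≥⇒<ᵇ≡false {suc a} {suc b} (s≤s b≤a) = ≥⇒<ᵇ≡false b≤a

straddle-index : ∀ {i L} → i < suc L → suc L < i + 2 → i ≡ L
straddle-index {i} {L} i<1+L 1+L<i+2 =
  ≤-antisym (m<1+n⇒m≤n i<1+L) (m<1+n⇒m≤n (m<1+n⇒m≤n (subst (suc L <_) (+-comm i 2) 1+L<i+2)))

pair-at-junction : ∀ {A : Set} (X : List A) p q Y →
  take 2 (drop (length X) ((X ∷ʳ p) ++ q ∷ Y)) ≡ p ∷ q ∷ []
pair-at-junction []      p q Y = refl
pair-at-junction (_ ∷ X) p q Y = pair-at-junction X p q Y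

φ*-∷ʳ : ∀ k u a → φ* k (u ∷ʳ a) ≡ φ* k u ++ φ k a
φ*-∷ʳ k u a = trans (concatMap-++ (φ k) u [ a ]) (cong (φ* k u ++_) (++-identityʳ (φ k a)))

Wdesc : ℕ → ℕ → ℕ → List ℕ
Wdesc k t c = concat (map (λ i → W k (t ∸ suc i)) (upTo c))

Wdesc-suc : ∀ k t c → Wdesc k t (suc c) ≡ Wdesc k t c ++ W k (t ∸ suc c)
Wdesc-suc k t c = begin
  concat (map f (upTo (suc c)))       ≡⟨ cong (concat ∘ map f) (upTo-∷ʳ c) ⟨
  concat (map f (upTo c ∷ʳ c))        ≡⟨ cong concat (map-++ f (upTo c) [ c ]) ⟩
  concat (map f (upTo c) ++ [ f c ])  ≡⟨ concat-++ (map f (upTo c)) [ f c ] ⟨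
  Wdesc k t c ++ (f c ++ [])          ≡⟨ cong (Wdesc k t c ++_) (++-identityʳ (f c)) ⟩
  Wdesc k t c ++ f c                  ∎
  where
  open ≡-Reasoning
  f : ℕ → List ℕ
  f i = W k (t ∸ suc i)

P≡Wdesc : ∀ k n → P k n ≡ Wdesc k n (n ∸ start k n)
P≡Wdesc k n = cong concat (map-cong (λ i → cong (W k) (∸-+-assoc n 1 i)) (upTo (n ∸ start k n)))

headT : ℕ → ℕ → ℕ
headT k n = if n <ᵇ k then n else k

junction-below : ∀ {k n} → n < k → start k n ∷ headT k n ∷ [] ≡ 0 ∷ n ∷ []
junction-below n<k rewrite m≤n⇒m∸n≡0 n<k | <⇒<ᵇ≡true n<k = refl

junction-above : ∀ {k n} → k ≤ n → start k n ∷ headT k n ∷ [] ≡ suc n ∸ k ∷ k ∷ []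
junction-above k≤n rewrite ≥⇒<ᵇ≡false k≤n = refl

module Junction {k n p q : ℕ} {X Y : List ℕ}
  (W≡ : W k n ≡ (X ∷ʳ p) ++ q ∷ Y) (P≡ : P k n ≡ X ∷ʳ p) where

  |P|≡1+|X| : length (P k n) ≡ suc (length X)
  |P|≡1+|X| = trans (cong length P≡) (trans (length-++ X) (+-comm (length X) 1))

  occurrence-at-junction : take 2 (drop (length X) (W k n)) ≡ p ∷ q ∷ []
  occurrence-at-junction = trans (cong (take 2 ∘ drop (length X)) W≡) (pair-at-junction X p q Y)

  straddling-junction : StraddlingAt k n (p ∷ q ∷ []) (length X)
  straddling-junction =
      occurrence-at-junction
    , subst (length X <_) (sym |P|≡1+|X|) ≤-refl
    , subst (_< length X + 2) (sym |P|≡1+|X|) (subst (suc (length X) <_) (+-comm 2 (length X)) ≤-refl)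

  straddling-unique : ∀ B i → length B ≡ 2 → StraddlingAt k n B i → B ≡ p ∷ q ∷ [] × i ≡ length X
  straddling-unique (b₁ ∷ b₂ ∷ []) i _ (occurs , i<|P| , |P|<i+2) = B≡pq , i≡|X|
    where
    i≡|X| : i ≡ length X
    i≡|X| = straddle-index (subst (i <_) |P|≡1+|X| i<|P|) (subst (_< i + 2) |P|≡1+|X| |P|<i+2)

    B≡pq : b₁ ∷ b₂ ∷ [] ≡ p ∷ q ∷ []
    B≡pq = begin
      b₁ ∷ b₂ ∷ []                     ≡⟨ occurs ⟨
      take 2 (drop i (W k n))          ≡⟨ cong (λ j → take 2 (drop j (W k n))) i≡|X| ⟩
      take 2 (drop (length X) (W k n)) ≡⟨ occurrence-at-junction ⟩
      p ∷ q ∷ []                       ∎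
      where open ≡-Reasoning

module _ (m : ℕ) where
  private
    k = suc m

  φ-below : ∀ {a} → suc a < k → φ k a ≡ 0 ∷ suc a ∷ []
  φ-below {a} 1+a<k
    rewrite m<n⇒m/n≡0 (<⇒≤ 1+a<k) | m<n⇒m%n≡m (<⇒≤ 1+a<k) | *-zeroʳ m | <⇒<ᵇ≡true 1+a<k = refl

  φ-top : φ k m ≡ k ∷ []
  φ-top rewrite m<n⇒m/n≡0 (n<1+n m) | m<n⇒m%n≡m (n<1+n m) | *-zeroʳ m | ≥⇒<ᵇ≡false (≤-refl {k}) = refl

  1+a≡k*[a/k]+1+[a%k] : ∀ a → suc a ≡ k * (a / k) + suc (a % k)
  1+a≡k*[a/k]+1+[a%k] a = begin
    suc a                      ≡⟨ cong suc (m≡m%n+[m/n]*n a k) ⟩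
    suc (a % k + a / k * k)    ≡⟨ cong suc (+-comm (a % k) (a / k * k)) ⟩
    suc (a / k * k + a % k)    ≡⟨ +-suc (a / k * k) (a % k) ⟨
    a / k * k + suc (a % k)    ≡⟨ cong (_+ suc (a % k)) (*-comm (a / k) k) ⟩
    k * (a / k) + suc (a % k)  ∎
    where open ≡-Reasoning

  φ-∷ʳ : ∀ a → ∃ λ u → φ k a ≡ u ∷ʳ suc a
  φ-∷ʳ a with suc (a % k) <ᵇ k | <ᵇ-reflects-< (suc (a % k)) k
  ... | true  | _ = [ k * (a / k) ] , cong (λ x → k * (a / k) ∷ x ∷ []) (sym (1+a≡k*[a/k]+1+[a%k] a))
  ... | false | ofⁿ 1+[a%k]≮k =
    [] , cong [_] (trans (cong (k * (a / k) +_) (sym 1+[a%k]≡k)) (sym (1+a≡k*[a/k]+1+[a%k] a)))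
    where
    1+[a%k]≡k : suc (a % k) ≡ k
    1+[a%k]≡k = ≤-antisym (m%n<n a k) (≮⇒≥ 1+[a%k]≮k)

  [k+a]/k≡1+[a/k] : ∀ a → (k + a) / k ≡ suc (a / k)
  [k+a]/k≡1+[a/k] a = trans (+-distrib-/-∣ˡ a ∣-refl) (cong (_+ a / k) (n/n≡1 k))

  φ-shift : ∀ a → φ k (k + a) ≡ k ⊕ φ k a
  φ-shift a rewrite [k+a]/k≡1+[a/k] a | %-remove-+ˡ {k} a ∣-refl with suc (a % k) <ᵇ k
  ... | true  = cong₂ (λ x y → x ∷ y ∷ []) (*-suc k (a / k))
                      (trans (cong (_+ suc (a % k)) (*-suc k (a / k))) (+-assoc k _ _))
  ... | false = cong [_] (trans (cong (_+ k) (*-suc k (a / k))) (+-assoc k _ _))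

  φ*-⊕ : ∀ w → φ* k (k ⊕ w) ≡ k ⊕ φ* k w
  φ*-⊕ []      = refl
  φ*-⊕ (a ∷ w) = begin
    φ k (k + a) ++ φ* k (k ⊕ w)  ≡⟨ cong₂ _++_ (φ-shift a) (φ*-⊕ w) ⟩
    k ⊕ φ k a ++ k ⊕ φ* k w      ≡⟨ map-++ (k +_) (φ k a) (φ* k w) ⟨
    k ⊕ φ* k (a ∷ w)             ∎
    where open ≡-Reasoning

  W-∷ʳ : ∀ d → ∃ λ u → W k d ≡ u ∷ʳ d
  W-∷ʳ zero = [] , refl
  W-∷ʳ (suc d) with W-∷ʳ d | φ-∷ʳ d
  ... | u , W≡ | v , φ≡ = φ* k u ++ v , (begin
    φ* k (W k d)            ≡⟨ cong (φ* k) W≡ ⟩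
    φ* k (u ∷ʳ d)           ≡⟨ φ*-∷ʳ k u d ⟩
    φ* k u ++ φ k d         ≡⟨ cong (φ* k u ++_) φ≡ ⟩
    φ* k u ++ (v ∷ʳ suc d)  ≡⟨ ++-assoc (φ* k u) v [ suc d ] ⟨
    (φ* k u ++ v) ∷ʳ suc d  ∎)
    where open ≡-Reasoning

  W-head : 1 < k → ∀ d → ∃ λ v → W k d ≡ 0 ∷ v
  W-head 1<k zero    = [] , refl
  W-head 1<k (suc d) with W-head 1<k d
  ... | v , W≡ = 1 ∷ φ* k v , trans (cong (φ* k) W≡) (cong (_++ φ* k v) (φ-below 1<k))

  Wdesc-∷ʳ : ∀ t {c} → 0 < c → ∃ λ X → Wdesc k t c ≡ X ∷ʳ (t ∸ c)
  Wdesc-∷ʳ t {suc c} _ with W-∷ʳ (t ∸ suc c)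
  ... | u , W≡ = Wdesc k t c ++ u , (begin
    Wdesc k t (suc c)                  ≡⟨ Wdesc-suc k t c ⟩
    Wdesc k t c ++ W k (t ∸ suc c)     ≡⟨ cong (Wdesc k t c ++_) W≡ ⟩
    Wdesc k t c ++ (u ∷ʳ (t ∸ suc c))  ≡⟨ ++-assoc (Wdesc k t c) u _ ⟨
    (Wdesc k t c ++ u) ∷ʳ (t ∸ suc c)  ∎)
    where open ≡-Reasoning

  P-∷ʳ-start : ∀ {n} → start k n < n → ∃ λ X → P k n ≡ X ∷ʳ start k n
  P-∷ʳ-start {n} s<n with Wdesc-∷ʳ n (m<n⇒0<n∸m s<n)
  ... | X , Wdesc≡ = X , (begin
    P k n                       ≡⟨ P≡Wdesc k n ⟩
    Wdesc k n (n ∸ start k n)   ≡⟨ Wdesc≡ ⟩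
    X ∷ʳ (n ∸ (n ∸ start k n))  ≡⟨ cong (X ∷ʳ_) (m∸[m∸n]≡n (<⇒≤ s<n)) ⟩
    X ∷ʳ start k n              ∎)
    where open ≡-Reasoning

  φ*-Wdesc : ∀ t c → c ≤ t → φ* k (Wdesc k t c) ≡ Wdesc k (suc t) c
  φ*-Wdesc t zero    _   = refl
  φ*-Wdesc t (suc c) c<t = begin
    φ* k (Wdesc k t (suc c))                     ≡⟨ cong (φ* k) (Wdesc-suc k t c) ⟩
    φ* k (Wdesc k t c ++ W k (t ∸ suc c))        ≡⟨ concatMap-++ (φ k) (Wdesc k t c) (W k (t ∸ suc c)) ⟩
    φ* k (Wdesc k t c) ++ W k (suc (t ∸ suc c))  ≡⟨ cong₂ _++_ (φ*-Wdesc t c (<⇒≤ c<t))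
                                                               (cong (W k) (sym (+-∸-assoc 1 c<t))) ⟩
    Wdesc k (suc t) c ++ W k (suc t ∸ suc c)     ≡⟨ Wdesc-suc k (suc t) c ⟨
    Wdesc k (suc t) (suc c)                      ∎
    where open ≡-Reasoning

  W-below : ∀ n → n < k → W k n ≡ Wdesc k n n ∷ʳ n
  W-below zero    _     = refl
  W-below (suc n) 1+n<k = begin
    φ* k (W k n)                                 ≡⟨ cong (φ* k) (W-below n (<⇒≤ 1+n<k)) ⟩
    φ* k (Wdesc k n n ∷ʳ n)                      ≡⟨ φ*-∷ʳ k (Wdesc k n n) n ⟩
    φ* k (Wdesc k n n) ++ φ k n                  ≡⟨ cong₂ _++_ (φ*-Wdesc n n ≤-refl) (φ-below 1+n<k) ⟩
    Wdesc k (suc n) n ++ 0 ∷ suc n ∷ []          ≡⟨ ++-assoc (Wdesc k (suc n) n) [ 0 ] [ suc n ] ⟨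
    (Wdesc k (suc n) n ++ W k 0) ∷ʳ suc n        ≡⟨ cong (λ x → (Wdesc k (suc n) n ++ W k x) ∷ʳ suc n) (n∸n≡0 n) ⟨
    (Wdesc k (suc n) n ++ W k (n ∸ n)) ∷ʳ suc n  ≡⟨ cong (_∷ʳ suc n) (Wdesc-suc k (suc n) n) ⟨
    Wdesc k (suc n) (suc n) ∷ʳ suc n             ∎
    where open ≡-Reasoning

  W[d+k] : ∀ d → W k (d + k) ≡ Wdesc k (d + k) m ++ k ⊕ W k d
  W[d+k] zero = begin
    φ* k (W k m)                 ≡⟨ cong (φ* k) (W-below m ≤-refl) ⟩
    φ* k (Wdesc k m m ∷ʳ m)      ≡⟨ φ*-∷ʳ k (Wdesc k m m) m ⟩
    φ* k (Wdesc k m m) ++ φ k m  ≡⟨ cong₂ _++_ (φ*-Wdesc m m ≤-refl) φ-top ⟩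
    Wdesc k k m ++ [ k ]         ≡⟨ cong (λ x → Wdesc k k m ++ [ x ]) (+-identityʳ k) ⟨
    Wdesc k k m ++ k ⊕ W k 0     ∎
    where open ≡-Reasoning
  W[d+k] (suc d) = begin
    φ* k (W k (d + k))                            ≡⟨ cong (φ* k) (W[d+k] d) ⟩
    φ* k (Wdesc k (d + k) m ++ k ⊕ W k d)         ≡⟨ concatMap-++ (φ k) (Wdesc k (d + k) m) (k ⊕ W k d) ⟩
    φ* k (Wdesc k (d + k) m) ++ φ* k (k ⊕ W k d)  ≡⟨ cong₂ _++_ (φ*-Wdesc (d + k) m m≤d+k) (φ*-⊕ (W k d)) ⟩
    Wdesc k (suc d + k) m ++ k ⊕ W k (suc d)      ∎
    where
    open ≡-Reasoning
    m≤d+k : m ≤ d + k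
    m≤d+k = ≤-trans (n≤1+n m) (m≤n+m k d)

  W-above : ∀ {n} → k ≤ n → W k n ≡ Wdesc k n m ++ k ⊕ W k (n ∸ k)
  W-above {n} k≤n =
    subst (λ x → W k x ≡ Wdesc k x m ++ k ⊕ W k (n ∸ k)) (m∸n+n≡m k≤n) (W[d+k] (n ∸ k))

  W≡P++T : ∀ n → W k n ≡ P k n ++ T k n
  W≡P++T n with n <? k
  ... | yes n<k rewrite <⇒<ᵇ≡true n<k = begin
    W k n                           ≡⟨ W-below n n<k ⟩
    Wdesc k n n ∷ʳ n                ≡⟨ cong (λ s → Wdesc k n (n ∸ s) ∷ʳ n) (m≤n⇒m∸n≡0 n<k) ⟨
    Wdesc k n (n ∸ start k n) ∷ʳ n  ≡⟨ cong (_∷ʳ n) (P≡Wdesc k n) ⟨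
    P k n ∷ʳ n                      ∎
    where open ≡-Reasoning
  ... | no n≮k rewrite ≥⇒<ᵇ≡false (≮⇒≥ n≮k) = begin
    W k n                                         ≡⟨ W-above (≮⇒≥ n≮k) ⟩
    Wdesc k n m ++ k ⊕ W k (n ∸ k)                ≡⟨ cong (λ c → Wdesc k n c ++ k ⊕ W k (n ∸ k))
                                                          (m∸[m∸n]≡n (<⇒≤ (≮⇒≥ n≮k))) ⟨
    Wdesc k n (n ∸ start k n) ++ k ⊕ W k (n ∸ k)  ≡⟨ cong (_++ k ⊕ W k (n ∸ k)) (P≡Wdesc k n) ⟨
    P k n ++ k ⊕ W k (n ∸ k)                      ∎
    where open ≡-Reasoning

  T-head : 1 < k → ∀ n → ∃ λ Y → T k n ≡ headT k n ∷ Y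
  T-head 1<k n with n <ᵇ k
  ... | true  = [] , refl
  ... | false with W-head 1<k (n ∸ k)
  ...   | v , W≡ = k ⊕ v , trans (cong (k ⊕_) W≡) (cong (_∷ k ⊕ v) (+-identityʳ k))

lemma5p2 : (k n : ℕ) → 2 ≤ k → 1 ≤ n →
    ((B : List ℕ) (i : ℕ) → length B ≡ 2 → StraddlingAt k n B i →
      (n < k → B ≡ 0 ∷ n ∷ []) × (k ≤ n → B ≡ (suc n ∸ k) ∷ k ∷ []))
    × Σ (List ℕ) (λ B → Σ ℕ (λ i → length B ≡ 2 × StraddlingAt k n B i
        × ((B′ : List ℕ) (i′ : ℕ) → length B′ ≡ 2 → StraddlingAt k n B′ i′ → (B′ ≡ B × i′ ≡ i))))
lemma5p2 k@(suc m@(suc j)) n@(suc a) 1<k@(s≤s (s≤s z≤n)) (s≤s z≤n)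
  with P-∷ʳ-start m (s≤s (m∸n≤m a j)) | T-head m 1<k n
... | X , P≡ | Y , T≡ =
      (λ B i |B|≡2 st → let B≡ = proj₁ (straddling-unique B i |B|≡2 st) in
          (λ n<k → trans B≡ (junction-below n<k)) , λ k≤n → trans B≡ (junction-above k≤n))
    , _ , length X , refl , straddling-junction , straddling-unique
  where open Junction {k} {n} (trans (W≡P++T m n) (cong₂ _++_ P≡ T≡)) P≡
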